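{- Let $\beta>1$ be a non-simple Parry number with canonical substitution $\varphi_\beta$. Let $k,\ell\in\mathcal A$, $k\neq\ell$, with $t_{\ell\oplus1}t_{\ell\oplus2}\cdots\succeq t_{k\oplus1}t_{k\oplus2}\cdots$ in the lexicographic order. Then for every $n\in\mathbb N$ the longest common prefix of $\varphi_\beta^n(k)$ and $\varphi_\beta^n(\ell)$ is $\varphi_\beta^n(k)$ with its last letter $k\oplus n$ removed. Moreover, if $c$ denotes the letter such that this longest common prefix followed by $c$ is a prefix of $\varphi_\beta^n(\ell)$, then $t_{c\oplus1}t_{c\oplus2}\cdots\succeq t_{k\oplus(n+1)}t_{k\oplus(n+2)}\cdots$.
   Context: For real $\beta>1$, $d_\beta(1)=t_1t_2\cdots$ with $t_i=\lfloor\beta T_\beta^{i-1}(1)\rfloor$, $T_\beta(x)=\{\beta x\}$, $T_\beta^0(1)=1$. $\beta$ is a non-simple Parry number if $d_\beta(1)$ is eventually periodic with infinitely many nonzero digits; write $d_\beta(1)=t_1\cdots t_m(t_{m+1}\cdots t_{m+p})^\omega$ with $m,p\ge1$ least possible. It satisfies the Parry condition $t_jt_{j+1}\cdots\prec t_1t_2\cdots$ for all $j>1$. Alphabet $\mathcal A=\{0,\dots,m+p-1\}$; $\varphi_\beta(k)=0^{t_{k+1}}(k+1)$ for $0\le k\le m+p-2$, $\varphi_\beta(m+p-1)=0^{t_{m+p}}m$. For $k,j\in\mathbb N$: $k\oplus j=k+j$ if $k+j<m+p$, else $m+((k+j-m)\bmod p)$. Separately, for $k+j>0$, the notation $t_{k\oplus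 j}$ means $t_{k+j}$ if $0<k+j<m+p+1$ and $t_{m+1+((k+j-m-1)\bmod p)}$ otherwise; $t_{k\oplus1}t_{k\oplus2}\cdots$ is the infinite sequence $(t_{k\oplus j})_{j\ge1}$. -}

module Defs where

open import Data.Nat using (ℕ; zero; suc; _+_; _∸_; _≤_; _<_; _<?_; _≤?_; _≟_)
open import Data.Nat.DivMod using (_%_)
open import Data.List using (List; []; _∷_; _++_; [_]; replicate; concatMap)
open import Data.Product using (Σ; ∃; _×_; _,_)
open import Data.Sum using (_⊎_)
open import Relation.Binary.PropositionalEquality using (_≡_; _≢_)
open import Relation.Nullary using (yes; no)

-- A digit sequence is a function t : ℕ → ℕ; t i stands for t_i (i ≥ 1);
-- the value t 0 is irrelevant and never used.

_≺_ : (ℕ → ℕ) → (ℕ → ℕ) → Set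
u ≺ v = ∃ λ n → (∀ i → i < n → u (suc i) ≡ v (suc i)) × u (suc n) < v (suc n)

_⪰_ : (ℕ → ℕ) → (ℕ → ℕ) → Set
u ⪰ v = (∀ i → u (suc i) ≡ v (suc i)) ⊎ (v ≺ u)

EvPeriodic : (ℕ → ℕ) → ℕ → ℕ → Set
EvPeriodic t m p = ∀ j → m < j → t (j + p) ≡ t j

-- Hypotheses: t = d_β(1) for a non-simple Parry number β > 1, written
-- t_1 ⋯ t_m (t_{m+1} ⋯ t_{m+p})^ω with m, p ≥ 1 least possible.
record NonSimpleParry (t : ℕ → ℕ) (m p : ℕ) : Set where
  field
    m≥1       : 1 ≤ m
    p≥1       : 1 ≤ p
    t₁≥1      : 1 ≤ t 1
    periodic  : EvPeriodic t m p
    minimal   : ∀ m′ p′ → 1 ≤ m′ → 1 ≤ p′ → EvPeriodic t m′ p′ → m ≤ m′ × p ≤ p′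
    infNonzero : ∀ N → ∃ λ j → N ≤ j × t j ≢ 0
    parry     : ∀ j → 1 < j → (λ i → t (j + i ∸ 1)) ≺ t

module Parry (t : ℕ → ℕ) (m p : ℕ) where

  -- x mod p (p ≥ 1 by hypothesis; suc (p ∸ 1) = p then)
  modP : ℕ → ℕ
  modP x = x % suc (p ∸ 1)

  _⊕_ : ℕ → ℕ → ℕ
  k ⊕ j with (k + j) <? (m + p)
  ... | yes _ = k + j
  ... | no  _ = m + modP (k + j ∸ m)

  -- index of t_{k⊕j}: i = k + j > 0 ↦ i if i < m+p+1, else m+1+((i-m-1) mod p)
  tIdx : ℕ → ℕ
  tIdx i with i ≤? (m + p)
  ... | yes _ = i
  ... | no  _ = suc (m + modP (i ∸ m ∸ 1))

  tSeq : ℕ → (ℕ → ℕ)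
  tSeq k j = t (tIdx (k + j))

  φ : ℕ → List ℕ
  φ k = replicate (t (suc k)) 0 ++ [ k ⊕ 1 ]

  φ* : List ℕ → List ℕ
  φ* = concatMap φ

  φ^ : ℕ → ℕ → List ℕ
  φ^ zero    k = [ k ]
  φ^ (suc n) k = φ* (φ^ n k)

lcp : List ℕ → List ℕ → List ℕ
lcp [] _ = []
lcp (_ ∷ _) [] = []
lcp (x ∷ xs) (y ∷ ys) with x ≟ y
... | yes _ = x ∷ lcp xs ys
... | no  _ = []

IsPrefix : List ℕ → List ℕ → Set
IsPrefix u v = ∃ λ s → u ++ s ≡ v

{-# OPTIONS --safe #-}
-- Track the first disagreement of φⁿ(k) and φⁿ(ℓ): φⁿ(k) = w a and φⁿ(ℓ) = w c …
-- with a = k ⊕ n ≠ c and t_{c⊕1} t_{c⊕2} ⋯ ⪰ t_{a⊕1} t_{a⊕2} ⋯. Applying φ, the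
-- common prefix grows by 0^{t_{a+1}}. If c has more leading zeros, φⁿ⁺¹(ℓ) continues
-- with 0, and the digit sequence of 0 is t itself, which dominates every shifted
-- sequence by the Parry condition. Otherwise the blocks agree, the next letters are
-- a ⊕ 1 and c ⊕ 1, and they differ because the only collision of x ↦ x ⊕ 1 on the
-- alphabet (m-1 and m+p-1 both go to m) would force t_m = t_{m+p}, contradicting the
-- minimality of the preperiod m (or, when m = 1, the Parry condition).
module Submission where

open import Defs
open import Data.Nat
  using (ℕ; zero; suc; _+_; _*_; _∸_; _≤_; _<_; z≤n; s≤s; z<s; s<s; _<?_; _≤?_; _≟_; NonZero)
open import Data.Nat.Properties
open import Data.Nat.DivMod
  using (_%_; _/_; m≡m%n+[m/n]*n; m%n<n; m%n%n≡m%n; %-distribˡ-+; m<n⇒m%n≡m; n%n≡0)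
open import Data.Nat.Tactic.RingSolver using (solve-∀)
open import Data.List using (List; []; _∷_; _++_; [_]; replicate)
open import Data.List.Properties using (++-assoc; concatMap-++)
open import Data.Product using (Σ; ∃; _×_; _,_; proj₁)
open import Data.Sum using (_⊎_; inj₁; inj₂; [_,_]′)
open import Function using (_∘_)
open import Relation.Nullary using (yes; no; ¬_; contradiction)
open import Relation.Binary.PropositionalEquality
  using (_≡_; _≢_; ≢-sym; refl; sym; trans; cong; cong₂; subst; subst₂; module ≡-Reasoning)

_≋_ : (ℕ → ℕ) → (ℕ → ℕ) → Set
u ≋ v = ∀ i → u (suc i) ≡ v (suc i)

≋-sym : ∀ {u v} → u ≋ v → v ≋ u
≋-sym u≋v i = sym (u≋v i)

tail : (ℕ → ℕ) → ℕ → ℕ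
tail u i = u (suc i)

≺-resp-≋ : ∀ {u u′ v v′} → u ≋ u′ → v ≋ v′ → u ≺ v → u′ ≺ v′
≺-resp-≋ u≋u′ v≋v′ (n , same , lt) =
  n , (λ i i<n → trans (sym (u≋u′ i)) (trans (same i i<n) (v≋v′ i))) ,
  subst₂ _<_ (u≋u′ n) (v≋v′ n) lt

⪰-resp-≋ : ∀ {u u′ v v′} → u ≋ u′ → v ≋ v′ → u ⪰ v → u′ ⪰ v′
⪰-resp-≋ u≋u′ v≋v′ (inj₁ u≋v) = inj₁ (λ i → trans (sym (u≋u′ i)) (trans (u≋v i) (v≋v′ i)))
⪰-resp-≋ {u} {u′} {v} {v′} u≋u′ v≋v′ (inj₂ v≺u) =
  inj₂ (≺-resp-≋ {v} {v′} {u} {u′} v≋v′ u≋u′ v≺u)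

≋⇒≮ : ∀ {u v} → u ≋ v → ¬ (u ≺ v)
≋⇒≮ u≋v (n , _ , lt) = <-irrefl (u≋v n) lt

⪰-head : ∀ {u v} → u ⪰ v → v 1 < u 1 ⊎ (u 1 ≡ v 1 × tail u ⪰ tail v)
⪰-head (inj₁ u≋v) = inj₂ (u≋v 0 , inj₁ (λ i → u≋v (suc i)))
⪰-head (inj₂ (zero , _ , lt)) = inj₁ lt
⪰-head (inj₂ (suc n , same , lt)) =
  inj₂ (sym (same 0 z<s) , inj₂ (n , (λ i i<n → same (suc i) (s<s i<n)) , lt))

lcp-++ : ∀ w {a c} r r′ → a ≢ c → lcp (w ++ a ∷ r) (w ++ c ∷ r′) ≡ w
lcp-++ [] {a} {c} r r′ a≢c with a ≟ c
... | yes a≡c = contradiction a≡c a≢c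
... | no _    = refl
lcp-++ (x ∷ w) r r′ a≢c with x ≟ x
... | yes _   = cong (x ∷_) (lcp-++ w r r′ a≢c)
... | no x≢x  = contradiction refl x≢x

++-replicate-+-suc : ∀ xs i j (x : ℕ) ys →
  (xs ++ replicate (i + suc j) x) ++ ys ≡ (xs ++ replicate i x) ++ x ∷ (replicate j x ++ ys)
++-replicate-+-suc xs i j x ys = begin
  (xs ++ replicate (i + suc j) x) ++ ys       ≡⟨ ++-assoc xs _ ys ⟩
  xs ++ replicate (i + suc j) x ++ ys         ≡⟨ cong (xs ++_) (replicate-+-suc i) ⟩
  xs ++ replicate i x ++ x ∷ (replicate j x ++ ys) ≡⟨ ++-assoc xs _ _ ⟨
  (xs ++ replicate i x) ++ x ∷ (replicate j x ++ ys) ∎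
  where
    open ≡-Reasoning
    replicate-+-suc : ∀ i →
      replicate (i + suc j) x ++ ys ≡ replicate i x ++ x ∷ (replicate j x ++ ys)
    replicate-+-suc zero    = refl
    replicate-+-suc (suc i) = cong (x ∷_) (replicate-+-suc i)

suc[m%n]%n≡suc[m]%n : ∀ m n .{{_ : NonZero n}} → suc (m % n) % n ≡ suc m % n
suc[m%n]%n≡suc[m]%n m n = begin
  (1 + m % n) % n             ≡⟨ %-distribˡ-+ 1 (m % n) n ⟩
  (1 % n + m % n % n) % n     ≡⟨ cong (λ r → (1 % n + r) % n) (m%n%n≡m%n m n) ⟩
  (1 % n + m % n) % n         ≡⟨ %-distribˡ-+ 1 m n ⟨
  (1 + m) % n                 ∎
  where open ≡-Reasoning

preperiod-pred : ∀ {t m p} → EvPeriodic t (suc m) p → t (suc m + p) ≡ t (suc m) →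
                 EvPeriodic t m p
preperiod-pred periodic eq j m<j with m≤n⇒m<n∨m≡n m<j
... | inj₁ suc[m]<j = periodic j suc[m]<j
... | inj₂ refl     = eq

t[m]≢t[m+p] : ∀ {t m p} → NonSimpleParry t m p → t m ≢ t (m + p)
t[m]≢t[m+p] {m = zero} H _ with NonSimpleParry.m≥1 H
... | ()
t[m]≢t[m+p] {t} {m = 1} {p} H eq = ≋⇒≮ {shifted} {t} shifted≋t (parry (suc p) (s≤s p≥1))
  where
    open NonSimpleParry H
    periodic₁ : ∀ i → t (suc i + p) ≡ t (suc i)
    periodic₁ zero    = sym eq
    periodic₁ (suc i) = periodic (suc (suc i)) (s<s z<s)
    shifted : ℕ → ℕ
    shifted i = t (suc p + i ∸ 1)
    shifted≋t : shifted ≋ t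
    shifted≋t i = trans (cong t (+-comm p (suc i))) (periodic₁ i)
t[m]≢t[m+p] {m = suc (suc m″)} {p} H eq =
  1+n≰n (proj₁ (minimal (suc m″) p (s≤s z≤n) p≥1 (preperiod-pred periodic (sym eq))))
  where open NonSimpleParry H

module _ (t : ℕ → ℕ) (m p : ℕ) where
  open Parry t m p

  φ*-++-∷ : ∀ w c r →
    φ* (w ++ c ∷ r) ≡ (φ* w ++ replicate (t (suc c)) 0) ++ (c ⊕ 1) ∷ φ* r
  φ*-++-∷ w c r = begin
    φ* (w ++ c ∷ r)
      ≡⟨ concatMap-++ φ w (c ∷ r) ⟩
    φ* w ++ (replicate (t (suc c)) 0 ++ [ c ⊕ 1 ]) ++ φ* r
      ≡⟨ cong (φ* w ++_) (++-assoc _ [ c ⊕ 1 ] (φ* r)) ⟩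
    φ* w ++ replicate (t (suc c)) 0 ++ (c ⊕ 1) ∷ φ* r
      ≡⟨ ++-assoc (φ* w) _ _ ⟨
    (φ* w ++ replicate (t (suc c)) 0) ++ (c ⊕ 1) ∷ φ* r
      ∎
    where open ≡-Reasoning

-- The letters 0, …, m+p-1 are normal forms of indices: norm x is the letter whose digit
-- sequence t_{x+1} t_{x+2} ⋯ is that of x, so that k ⊕ j = norm (k + j).
module Letters (t : ℕ → ℕ) (m p′ : ℕ) where
  open Parry t m (suc p′)

  p : ℕ
  p = suc p′

  after : ℕ → ℕ → ℕ
  after s i = t (s + i)

  norm : ℕ → ℕ
  norm x with x <? m
  ... | yes _ = x
  ... | no  _ = m + (x ∸ m) % p

  norm-< : ∀ {x} → x < m → norm x ≡ x
  norm-< {x} x<m with x <? m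
  ... | yes _   = refl
  ... | no x≮m  = contradiction x<m x≮m

  norm-≥ : ∀ {x} → m ≤ x → norm x ≡ m + (x ∸ m) % p
  norm-≥ {x} m≤x with x <? m
  ... | yes x<m = contradiction m≤x (<⇒≱ x<m)
  ... | no _    = refl

  norm-m+ : ∀ y → norm (m + y) ≡ m + y % p
  norm-m+ y = trans (norm-≥ (m≤m+n m y)) (cong (λ z → m + z % p) (m+n∸m≡n m y))

  data Position : ℕ → Set where
    below : ∀ {x} → x < m → Position x
    above : ∀ y → Position (m + y)

  position : ∀ x → Position x
  position x with x <? m
  ... | yes x<m = below x<m
  ... | no x≮m with m≤n⇒∃[o]m+o≡n (≮⇒≥ x≮m)
  ...   | y , refl = above y

  norm-id : ∀ {x} → x < m + p → norm x ≡ x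
  norm-id {x} x<m+p with position x
  ... | below x<m = norm-< x<m
  ... | above y   = trans (norm-m+ y) (cong (m +_) (m<n⇒m%n≡m (+-cancelˡ-< m y p x<m+p)))

  norm<m+p : ∀ x → norm x < m + p
  norm<m+p x with position x
  ... | below x<m = subst (_< m + p) (sym (norm-< x<m)) (≤-trans x<m (m≤m+n m p))
  ... | above y   = subst (_< m + p) (sym (norm-m+ y)) (+-monoʳ-< m (m%n<n y p))

  norm[m+p]≡m : norm (m + p) ≡ m
  norm[m+p]≡m = trans (norm-m+ p) (trans (cong (m +_) (n%n≡0 p)) (+-identityʳ m))

  norm-≢0 : 1 ≤ m → ∀ {x} → x ≢ 0 → norm x ≢ 0
  norm-≢0 m≥1 {x} x≢0 with position x
  ... | below x<m = subst (_≢ 0) (sym (norm-< x<m)) x≢0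
  ... | above y   = subst (_≢ 0) (sym (norm-m+ y)) (>⇒≢ m≥1 ∘ m+n≡0⇒m≡0 m)

  norm-suc-norm : ∀ x → norm (suc (norm x)) ≡ norm (suc x)
  norm-suc-norm x with position x
  ... | below x<m = cong (norm ∘ suc) (norm-< x<m)
  ... | above y   = begin
    norm (suc (norm (m + y)))  ≡⟨ cong (norm ∘ suc) (norm-m+ y) ⟩
    norm (suc (m + y % p))     ≡⟨ cong norm (+-suc m (y % p)) ⟨
    norm (m + suc (y % p))     ≡⟨ norm-m+ (suc (y % p)) ⟩
    m + suc (y % p) % p        ≡⟨ cong (m +_) (suc[m%n]%n≡suc[m]%n y p) ⟩
    m + suc y % p              ≡⟨ norm-m+ (suc y) ⟨
    norm (m + suc y)           ≡⟨ cong norm (+-suc m y) ⟩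
    norm (suc (m + y))         ∎
    where open ≡-Reasoning

  ⊕≡norm : ∀ a b → a ⊕ b ≡ norm (a + b)
  ⊕≡norm a b with a + b <? m + p
  ... | yes a+b<m+p = sym (norm-id a+b<m+p)
  ... | no a+b≮m+p  = sym (norm-≥ (≤-trans (m≤m+n m p) (≮⇒≥ a+b≮m+p)))

  ⊕1≡norm-suc : ∀ a → a ⊕ 1 ≡ norm (suc a)
  ⊕1≡norm-suc a = trans (⊕≡norm a 1) (cong norm (+-comm a 1))

  ⊕-suc : ∀ a b → (a ⊕ b) ⊕ 1 ≡ a ⊕ suc b
  ⊕-suc a b = begin
    (a ⊕ b) ⊕ 1          ≡⟨ ⊕1≡norm-suc (a ⊕ b) ⟩
    norm (suc (a ⊕ b))   ≡⟨ cong (norm ∘ suc) (⊕≡norm a b) ⟩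
    norm (suc (norm (a + b))) ≡⟨ norm-suc-norm (a + b) ⟩
    norm (suc (a + b))   ≡⟨ cong norm (+-suc a b) ⟨
    norm (a + suc b)     ≡⟨ ⊕≡norm a (suc b) ⟨
    a ⊕ suc b            ∎
    where open ≡-Reasoning

  ⊕<m+p : ∀ a b → a ⊕ b < m + p
  ⊕<m+p a b = subst (_< m + p) (sym (⊕≡norm a b)) (norm<m+p (a + b))

  ⊕-identityʳ : ∀ {a} → a < m + p → a ⊕ 0 ≡ a
  ⊕-identityʳ {a} a<m+p =
    trans (⊕≡norm a 0) (trans (cong norm (+-identityʳ a)) (norm-id a<m+p))

  ⊕-suc≢0 : 1 ≤ m → ∀ a b → a ⊕ suc b ≢ 0
  ⊕-suc≢0 m≥1 a b = subst (_≢ 0) (sym (⊕≡norm a (suc b))) (norm-≢0 m≥1 (m+1+n≢0 a))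

  tIdx-suc : ∀ y → tIdx (suc y) ≡ suc (norm y)
  tIdx-suc y with suc y ≤? m + p
  ... | yes y<m+p = cong suc (sym (norm-id y<m+p))
  ... | no y≮m+p  =
    cong suc (trans (cong (λ z → m + (z ∸ 1) % p) (+-∸-assoc 1 m≤y)) (sym (norm-≥ m≤y)))
    where
      m≤y : m ≤ y
      m≤y = ≤-trans (m≤m+n m p) (≤-pred (≰⇒> y≮m+p))

  module _ (periodic : EvPeriodic t m p) where

    periodic-* : ∀ q {j} → m < j → t (j + q * p) ≡ t j
    periodic-* zero    {j} _   = cong t (+-identityʳ j)
    periodic-* (suc q) {j} m<j = begin
      t (j + (p + q * p))  ≡⟨ cong t (+-assoc j p (q * p)) ⟨
      t (j + p + q * p)    ≡⟨ periodic-* q (<-≤-trans m<j (m≤m+n j p)) ⟩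
      t (j + p)            ≡⟨ periodic j m<j ⟩
      t j                  ∎
      where open ≡-Reasoning

    after-norm : ∀ x → after (norm x) ≋ after x
    after-norm x i with position x
    ... | below x<m = cong (λ z → t (z + suc i)) (norm-< x<m)
    ... | above y   = begin
      t (norm (m + y) + suc i)             ≡⟨ cong (λ z → t (z + suc i)) (norm-m+ y) ⟩
      t (m + r + suc i)                    ≡⟨ periodic-* q m<m+r+suc[i] ⟨
      t (m + r + suc i + q * p)            ≡⟨ cong t (rearrange m r (q * p) (suc i)) ⟩
      t (m + (r + q * p) + suc i)          ≡⟨ cong (λ z → t (m + z + suc i)) (m≡m%n+[m/n]*n y p) ⟨
      t (m + y + suc i)                    ∎
      where
        open ≡-Reasoning
        r = y % p
        q = y / p
        rearrange : ∀ a b c d → a + b + d + c ≡ a + (b + c) + d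
        rearrange = solve-∀
        m<m+r+suc[i] : m < m + r + suc i
        m<m+r+suc[i] = ≤-<-trans (m≤m+n m r) (m<m+n (m + r) z<s)

    after-⊕ : ∀ a b → after (a ⊕ b) ≋ after (a + b)
    after-⊕ a b i = trans (cong (λ z → t (z + suc i)) (⊕≡norm a b)) (after-norm (a + b) i)

    tail-after : ∀ s → tail (after s) ≋ after (s ⊕ 1)
    tail-after s i = sym (trans (after-⊕ s 1 i) (cong t (+-assoc s 1 (suc i))))

    t-tIdx : ∀ x → t (tIdx x) ≡ t x
    t-tIdx zero    = refl
    t-tIdx (suc y) = begin
      t (tIdx (suc y))  ≡⟨ cong t (tIdx-suc y) ⟩
      t (suc (norm y))  ≡⟨ cong t (+-comm 1 (norm y)) ⟩
      t (norm y + 1)    ≡⟨ after-norm y 0 ⟩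
      t (y + 1)         ≡⟨ cong t (+-comm y 1) ⟩
      t (suc y)         ∎
      where open ≡-Reasoning

    tSeq≋after : ∀ s → tSeq s ≋ after s
    tSeq≋after s i = t-tIdx (s + suc i)

module _ {t : ℕ → ℕ} {m p′ : ℕ} (H : NonSimpleParry t m (suc p′)) where
  open NonSimpleParry H
  open Parry t m (suc p′)
  open Letters t m p′

  wraparound-≢ : ∀ {x y} → suc x < m + p → suc y ≡ m + p → t (suc x) ≡ t (suc y) →
                 norm (suc x) ≢ norm (suc y)
  wraparound-≢ {x} {y} x+1<m+p y+1≡m+p tx≡ty nx≡ny = t[m]≢t[m+p] H (begin
    t m               ≡⟨ cong t m≡norm[x+1] ⟩
    t (norm (suc x))  ≡⟨ cong t (norm-id x+1<m+p) ⟩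
    t (suc x)         ≡⟨ tx≡ty ⟩
    t (suc y)         ≡⟨ cong t y+1≡m+p ⟩
    t (m + p)         ∎)
    where
      open ≡-Reasoning
      m≡norm[x+1] : m ≡ norm (suc x)
      m≡norm[x+1] = trans (sym norm[m+p]≡m) (trans (cong norm (sym y+1≡m+p)) (sym nx≡ny))

  norm-suc-injective : ∀ {a c} → a < m + p → c < m + p → t (suc a) ≡ t (suc c) →
                       norm (suc a) ≡ norm (suc c) → a ≡ c
  norm-suc-injective a<m+p c<m+p ta≡tc na≡nc
    with m≤n⇒m<n∨m≡n a<m+p | m≤n⇒m<n∨m≡n c<m+p
  ... | inj₁ a+1<m+p | inj₁ c+1<m+p =
    suc-injective (trans (sym (norm-id a+1<m+p)) (trans na≡nc (norm-id c+1<m+p)))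
  ... | inj₂ a+1≡m+p | inj₂ c+1≡m+p = suc-injective (trans a+1≡m+p (sym c+1≡m+p))
  ... | inj₁ a+1<m+p | inj₂ c+1≡m+p = contradiction na≡nc (wraparound-≢ a+1<m+p c+1≡m+p ta≡tc)
  ... | inj₂ a+1≡m+p | inj₁ c+1<m+p =
    contradiction (sym na≡nc) (wraparound-≢ c+1<m+p a+1≡m+p (sym ta≡tc))

  ⊕1-injective : ∀ {a c} → a < m + p → c < m + p → t (suc a) ≡ t (suc c) →
                 a ⊕ 1 ≡ c ⊕ 1 → a ≡ c
  ⊕1-injective {a} {c} a<m+p c<m+p ta≡tc a⊕1≡c⊕1 = norm-suc-injective a<m+p c<m+p ta≡tc
    (trans (sym (⊕1≡norm-suc a)) (trans a⊕1≡c⊕1 (⊕1≡norm-suc c)))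

  after-⊕-suc≺t : ∀ a b → after (a ⊕ suc b) ≺ t
  after-⊕-suc≺t a b =
    ≺-resp-≋ {after (a + suc b)} {after (a ⊕ suc b)} {t} {t}
      (≋-sym {after (a ⊕ suc b)} {after (a + suc b)} (after-⊕ periodic a (suc b))) (λ _ → refl)
      (parry (suc (a + suc b)) (s≤s (n≢0⇒n>0 (m+1+n≢0 a))))

  record Divergence (k ℓ n : ℕ) : Set where
    constructor divergence
    field
      w       : List ℕ
      c       : ℕ
      r       : List ℕ
      φⁿ[k]   : φ^ n k ≡ w ++ [ k ⊕ n ]
      φⁿ[ℓ]   : φ^ n ℓ ≡ w ++ c ∷ r
      c<m+p   : c < m + p
      c≢k⊕n   : c ≢ k ⊕ n
      c⪰k⊕n   : after c ⪰ after (k ⊕ n)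

  divergence-zero : ∀ {k ℓ} → k < m + p → ℓ < m + p → k ≢ ℓ → tSeq ℓ ⪰ tSeq k →
                    Divergence k ℓ 0
  divergence-zero {k} {ℓ} k<m+p ℓ<m+p k≢ℓ ℓ⪰k =
    divergence [] ℓ [] (cong [_] (sym k⊕0≡k)) refl ℓ<m+p
      (λ ℓ≡k⊕0 → k≢ℓ (sym (trans ℓ≡k⊕0 k⊕0≡k)))
      (⪰-resp-≋ {tSeq ℓ} {after ℓ} {tSeq k} {after (k ⊕ 0)}
        (tSeq≋after periodic ℓ) tSeq≋after[k⊕0] ℓ⪰k)
    where
      k⊕0≡k : k ⊕ 0 ≡ k
      k⊕0≡k = ⊕-identityʳ k<m+p
      tSeq≋after[k⊕0] : tSeq k ≋ after (k ⊕ 0)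
      tSeq≋after[k⊕0] i =
        trans (tSeq≋after periodic k i) (cong (λ z → after z (suc i)) (sym k⊕0≡k))

  divergence-suc : ∀ {k ℓ n} → Divergence k ℓ n → Divergence k ℓ (suc n)
  divergence-suc {k} {ℓ} {n} (divergence w c r φⁿ[k] φⁿ[ℓ] c<m+p c≢a c⪰a) =
    [ more-zeros , same-zeros ]′ (⪰-head {after c} {after a} c⪰a)
    where
      a : ℕ
      a = k ⊕ n
      w′ : List ℕ
      w′ = φ* w ++ replicate (t (suc a)) 0

      first-digit : ∀ s → after s 1 ≡ t (suc s)
      first-digit s = cong t (+-comm s 1)

      φⁿ⁺¹[k] : φ^ (suc n) k ≡ w′ ++ [ k ⊕ suc n ]
      φⁿ⁺¹[k] = trans (cong φ* φⁿ[k])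
                (trans (φ*-++-∷ t m p w a []) (cong (λ b → w′ ++ [ b ]) (⊕-suc k n)))

      φⁿ⁺¹[ℓ] : ∀ {z} → t (suc c) ≡ z →
                φ^ (suc n) ℓ ≡ (φ* w ++ replicate z 0) ++ (c ⊕ 1) ∷ φ* r
      φⁿ⁺¹[ℓ] refl = trans (cong φ* φⁿ[ℓ]) (φ*-++-∷ t m p w c r)

      more-zeros : after a 1 < after c 1 → Divergence k ℓ (suc n)
      more-zeros ta<tc with m≤n⇒∃[o]m+o≡n (subst₂ _<_ (first-digit a) (first-digit c) ta<tc)
      ... | o , ta+1+o≡tc =
        divergence w′ 0 (replicate o 0 ++ (c ⊕ 1) ∷ φ* r)
          φⁿ⁺¹[k]
          (trans (φⁿ⁺¹[ℓ] (sym (trans (+-suc _ o) ta+1+o≡tc)))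
                 (++-replicate-+-suc (φ* w) _ o 0 _))
          (≤-trans m≥1 (m≤m+n m p))
          (≢-sym (⊕-suc≢0 m≥1 k n))
          (inj₂ (after-⊕-suc≺t k n))

      same-zeros : after c 1 ≡ after a 1 × tail (after c) ⪰ tail (after a) →
                   Divergence k ℓ (suc n)
      same-zeros (tc≡ta , tail⪰) =
        divergence w′ (c ⊕ 1) (φ* r)
          φⁿ⁺¹[k]
          (φⁿ⁺¹[ℓ] tc≡ta′)
          (⊕<m+p c 1)
          (λ c⊕1≡k⊕n+1 →
             c≢a (⊕1-injective c<m+p (⊕<m+p k n) tc≡ta′ (trans c⊕1≡k⊕n+1 (sym (⊕-suc k n)))))
          (⪰-resp-≋ {tail (after c)} {after (c ⊕ 1)} {tail (after a)} {after (k ⊕ suc n)}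
            (tail-after periodic c) tail≋after[k⊕n+1] tail⪰)
        where
          tc≡ta′ : t (suc c) ≡ t (suc a)
          tc≡ta′ = trans (sym (first-digit c)) (trans tc≡ta (first-digit a))
          tail≋after[k⊕n+1] : tail (after a) ≋ after (k ⊕ suc n)
          tail≋after[k⊕n+1] i =
            trans (tail-after periodic a i) (cong (λ z → after z (suc i)) (⊕-suc k n))

  divergence-at : ∀ {k ℓ} → Divergence k ℓ 0 → ∀ n → Divergence k ℓ n
  divergence-at D₀ zero    = D₀
  divergence-at D₀ (suc n) = divergence-suc (divergence-at D₀ n)

mainTheorem10 : (t : ℕ → ℕ) (m p : ℕ) → NonSimpleParry t m p →
    let open Parry t m p in
    (k ℓ : ℕ) → k < m + p → ℓ < m + p → k ≢ ℓ →
    tSeq ℓ ⪰ tSeq k →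
    (n : ℕ) → ∃ λ w →
      φ^ n k ≡ w ++ [ k ⊕ n ] ×
      lcp (φ^ n k) (φ^ n ℓ) ≡ w ×
      Σ ℕ (λ c → IsPrefix (w ++ [ c ]) (φ^ n ℓ) ×
                 tSeq c ⪰ (λ j → t (tIdx (k + (n + j)))))
mainTheorem10 t m zero H with NonSimpleParry.p≥1 H
... | ()
mainTheorem10 t m (suc p′) H k ℓ k<m+p ℓ<m+p k≢ℓ ℓ⪰k n =
  w , φⁿ[k] , trans (cong₂ lcp φⁿ[k] φⁿ[ℓ]) (lcp-++ w [] r (c≢k⊕n ∘ sym)) ,
  c , (r , trans (++-assoc w [ c ] r) (sym φⁿ[ℓ])) ,
  ⪰-resp-≋ {after c} {tSeq c} {after (k ⊕ n)} {λ j → t (tIdx (k + (n + j)))}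
    (≋-sym {tSeq c} {after c} (tSeq≋after periodic c)) after≋target c⪰k⊕n
  where
    open NonSimpleParry H using (periodic)
    open Parry t m (suc p′)
    open Letters t m p′
    open Divergence (divergence-at H (divergence-zero H k<m+p ℓ<m+p k≢ℓ ℓ⪰k) n)
    after≋target : after (k ⊕ n) ≋ (λ j → t (tIdx (k + (n + j))))
    after≋target i = trans (after-⊕ periodic k n i)
      (trans (cong t (+-assoc k n (suc i))) (sym (t-tIdx periodic (k + (n + suc i)))))
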